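{- Let $G$ be a connected graph and $(V,\rho)$ its induced metric. Let $Q$ be a positive integer and let $\{a_1,b_1\},\dots,\{a_Q,b_Q\}$ be $Q$ pairs of vertices such that for all $1\le i\neq j\le Q$: $\overline{a_ib_i}=\overline{a_jb_j}$ and the pairs $\{a_i,b_i\}$ and $\{a_j,b_j\}$ are $\gamma$-related. Then $(V,\rho)$ has at least $(1/2-o(1))Q^2$ distinct lines, where $o(1)\to 0$ as $Q\to\infty$.
   Context: The metric induced by a connected graph $G$ on vertex set $V$ is $\rho(u,v)=$ length of a shortest $u$–$v$ path. For distinct points $p,q,r$ write $[pqr]$ if $\rho(p,r)=\rho(p,q)+\rho(q,r)$; $\{p,q,r\}$ is collinear if one of $[pqr],[qrp],[rpq]$ holds. For distinct $a,b$: $I(a,b)=\{x : [axb]\}$, $O(a,b)=\{x : [xab]\text{ or }[abx]\}$, and the line $\overline{ab}=\{a,b\}\cup I(a,b)\cup O(a,b)$. For four distinct points, $(a,b,c,d)$ is a parallelogram if $[abc]$, $[bcd]$, $[cda]$, $[dab]$ hold; pairs $\{a,b\}$, $\{c,d\}$ are antipodal if $(a,c,b,d)$ is a parallelogram. Pairs $\{a,b\}\neq\{x,y\}$ (with $a\ne b$, $x\ne y$) are $\gamma$-related if $\overline{ab}=\overline{xy}$, they are antipodal, and $O(a,b)=O(x,y)=\emptyset$. -}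

module Defs where

open import Level using (0ℓ)
open import Data.Nat using (ℕ; zero; suc; _+_; _*_; _≤_)
open import Data.Fin using (Fin)
open import Data.Product using (Σ; ∃; _×_; _,_)
open import Data.Sum using (_⊎_)
open import Data.Empty using (⊥)
open import Relation.Nullary using (¬_)
open import Relation.Binary.PropositionalEquality using (_≡_; _≢_)

record Graph (n : ℕ) : Set₁ where
  field
    Adj     : Fin n → Fin n → Set
    symAdj  : ∀ {u v} → Adj u v → Adj v u
    irrefl  : ∀ {u} → ¬ Adj u u

module _ {n : ℕ} (G : Graph n) where
  open Graph G

  data Walk : Fin n → Fin n → ℕ → Set where
    here : ∀ {u} → Walk u u 0
    step : ∀ {u w v k} → Adj u w → Walk w v k → Walk u v (suc k)

  Connected : Set
  Connected = ∀ u v → ∃ λ k → Walk u v k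

  Dist : Fin n → Fin n → ℕ → Set
  Dist u v d = Walk u v d × (∀ k → Walk u v k → d ≤ k)

  Betw : Fin n → Fin n → Fin n → Set
  Betw p q r = p ≢ q × q ≢ r × p ≢ r ×
    Σ ℕ λ d₁ → Σ ℕ λ d₂ → Dist p q d₁ × Dist q r d₂ × Dist p r (d₁ + d₂)

  I : Fin n → Fin n → Fin n → Set
  I a b x = Betw a x b

  O : Fin n → Fin n → Fin n → Set
  O a b x = Betw x a b ⊎ Betw a b x

  Line : Fin n → Fin n → Fin n → Set
  Line a b x = x ≡ a ⊎ x ≡ b ⊎ I a b x ⊎ O a b x

  SameLine : Fin n → Fin n → Fin n → Fin n → Set
  SameLine a b x y = ∀ z → (Line a b z → Line x y z) × (Line x y z → Line a b z)

  OEmpty : Fin n → Fin n → Set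
  OEmpty a b = ∀ z → ¬ O a b z

  Parallelogram : Fin n → Fin n → Fin n → Fin n → Set
  Parallelogram a b c d = Betw a b c × Betw b c d × Betw c d a × Betw d a b

  Antipodal : Fin n → Fin n → Fin n → Fin n → Set
  Antipodal a b c d = Parallelogram a c b d

  SamePair : Fin n → Fin n → Fin n → Fin n → Set
  SamePair a b x y = (a ≡ x × b ≡ y) ⊎ (a ≡ y × b ≡ x)

  γRelated : Fin n → Fin n → Fin n → Fin n → Set
  γRelated a b x y =
    a ≢ b × x ≢ y × ¬ SamePair a b x y ×
    SameLine a b x y × Antipodal a b x y × OEmpty a b × OEmpty x y

  AtLeastLines : ℕ → Set
  AtLeastLines m = Σ (Fin m → Fin n) λ u → Σ (Fin m → Fin n) λ v →
    (∀ k → u k ≢ v k) × (∀ k l → k ≢ l → ¬ SameLine (u k) (v k) (u l) (v l))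

-- Pairwise antipodal pairs {aᵢ, bᵢ} all have the same length D, and for any two of the
-- 2Q endpoints P, R one has ρ(P,R) + ρ(P,R*) = D, where R* is the other endpoint of R's pair.
-- For i > j choose an endpoint β of pair j with ρ(aᵢ,β) ≥ 2 (possible unless D = 2); the
-- Q(Q−1)/2 lines aᵢβ are pairwise distinct. Indeed, an endpoint lying on a line together with
-- its opposite cannot be interior, so on two equal lines every generator of one lies behind a
-- generator of the other; then the first vertex of a geodesic leaving a generator (or its
-- opposite) towards the other one lies on exactly one of the two lines. When D = 2 all distances
-- between different pairs are 1, and the line aᵢβ meets no endpoint outside pairs i and j.
module Submission where

open import Defs
open import Data.Bool using (Bool; true; false; not)
open import Data.Empty using (⊥; ⊥-elim)
open import Data.Fin using (Fin; toℕ; fromℕ; inject₁; splitAt; join; _≟_) renaming (zero to fzero; suc to fsuc)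
open import Data.Fin.Properties using (toℕ-inject₁; toℕ-fromℕ; toℕ<n; inject₁-injective; join-splitAt)
open import Data.List using (_∷_; [])
open import Data.Nat using (ℕ; zero; suc; _+_; _*_; _≤_; _<_; z≤n; s≤s; _≤?_)
open import Data.Nat.Properties hiding (_≟_)
open import Data.Nat.Tactic.RingSolver using (solve-∀; solve)
open import Data.Product using (Σ; ∃; _×_; _,_; proj₁; proj₂)
open import Function using (_∘_)
open import Data.Sum using (_⊎_; inj₁; inj₂)
open import Relation.Nullary using (¬_; Dec; yes; no)
open import Relation.Nullary.Decidable using (isYes)
open import Relation.Binary.PropositionalEquality
open import Algebra.Properties.CommutativeSemigroup +-commutativeSemigroup using (interchange)

pattern at-left e   = inj₁ e
pattern at-right e  = inj₂ (inj₁ e)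
pattern inside B    = inj₂ (inj₂ (inj₁ B))
pattern before B    = inj₂ (inj₂ (inj₂ (inj₁ B)))
pattern beyond B    = inj₂ (inj₂ (inj₂ (inj₂ B)))

m+m≡n+n⇒m≡n : ∀ m n → m + m ≡ n + n → m ≡ n
m+m≡n+n⇒m≡n m n e =
  *-cancelˡ-≡ m n 2 (trans (cong (m +_) (+-identityʳ m)) (trans e (cong (n +_) (sym (+-identityʳ n)))))

-- Geodesics in graphs

module Metric {n : ℕ} (G : Graph n) where
  open Graph G

  cast : ∀ {u v k l} → k ≡ l → Walk G u v k → Walk G u v l
  cast refl w = w

  _++ʷ_ : ∀ {u v w k l} → Walk G u v k → Walk G v w l → Walk G u w (k + l)
  here ++ʷ q = q
  step e p ++ʷ q = step e (p ++ʷ q)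

  reverse : ∀ {u v k} → Walk G u v k → Walk G v u k
  reverse {k = k} p = cast (+-identityʳ k) (onto p here)
    where
    onto : ∀ {u v w k l} → Walk G u v k → Walk G u w l → Walk G v w (k + l)
    onto here acc = acc
    onto {k = suc k} {l} (step e p) acc = cast (+-suc k l) (onto p (step (symAdj e) acc))

  first-step : ∀ {u v k} → Walk G u v (suc k) → Σ (Fin n) λ w → Adj u w × Walk G w v k
  first-step (step e rest) = _ , e , rest

  Dist-unique : ∀ {u v d d′} → Dist G u v d → Dist G u v d′ → d ≡ d′
  Dist-unique (p , min) (p′ , min′) = ≤-antisym (min _ p′) (min′ _ p)

  Dist-sym : ∀ {u v d} → Dist G u v d → Dist G v u d
  Dist-sym (p , min) = reverse p , λ k q → min k (reverse q)

  Dist-refl : ∀ {u} → Dist G u u 0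
  Dist-refl = here , λ _ _ → z≤n

  Dist-0⇒≡ : ∀ {u v} → Dist G u v 0 → u ≡ v
  Dist-0⇒≡ (here , _) = refl

  ≡⇒Dist-0 : ∀ {u v d} → u ≡ v → Dist G u v d → d ≡ 0
  ≡⇒Dist-0 refl D = Dist-unique D Dist-refl

  Dist-≢0⇒≢ : ∀ {u v d} → Dist G u v d → d ≢ 0 → u ≢ v
  Dist-≢0⇒≢ D d≢0 u≡v = d≢0 (≡⇒Dist-0 u≡v D)

  ≢⇒Dist-pos : ∀ {u v d} → u ≢ v → Dist G u v d → 1 ≤ d
  ≢⇒Dist-pos {d = zero} u≢v D = ⊥-elim (u≢v (Dist-0⇒≡ D))
  ≢⇒Dist-pos {d = suc d} u≢v D = s≤s z≤n

  betw : ∀ {p q r d₁ d₂ d₃} → p ≢ q → q ≢ r → p ≢ r →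
         Dist G p q d₁ → Dist G q r d₂ → Dist G p r d₃ → d₃ ≡ d₁ + d₂ → Betw G p q r
  betw p≢q q≢r p≢r D₁ D₂ D₃ eq = p≢q , q≢r , p≢r , _ , _ , D₁ , D₂ , subst (Dist G _ _) eq D₃

  Betw⇒≡+ : ∀ {p q r d₁ d₂ d₃} → Betw G p q r →
            Dist G p q d₁ → Dist G q r d₂ → Dist G p r d₃ → d₃ ≡ d₁ + d₂
  Betw⇒≡+ (_ , _ , _ , _ , _ , E₁ , E₂ , E₃) D₁ D₂ D₃ =
    trans (Dist-unique D₃ E₃) (cong₂ _+_ (Dist-unique E₁ D₁) (Dist-unique E₂ D₂))

  Betw-reverse : ∀ {p q r} → Betw G p q r → Betw G r q p
  Betw-reverse (p≢q , q≢r , p≢r , d₁ , d₂ , D₁ , D₂ , D₃) =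
    (λ e → q≢r (sym e)) , (λ e → p≢q (sym e)) , (λ e → p≢r (sym e)) , d₂ , d₁ ,
    Dist-sym D₂ , Dist-sym D₁ , subst (Dist G _ _) (+-comm d₁ d₂) (Dist-sym D₃)

  Line-swap : ∀ {x y z} → Line G x y z → Line G y x z
  Line-swap (at-left e) = at-right e
  Line-swap (at-right e) = at-left e
  Line-swap (inside B) = inside (Betw-reverse B)
  Line-swap (before B) = beyond (Betw-reverse B)
  Line-swap (beyond B) = before (Betw-reverse B)

  SameLine-swapˡ : ∀ {x y u v} → SameLine G x y u v → SameLine G y x u v
  SameLine-swapˡ same z = (λ l → proj₁ (same z) (Line-swap l)) , (λ l → Line-swap (proj₂ (same z) l))

  -- w is the vertex after x on a geodesic from x to y, and x lies on a geodesic from z to y.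
  Dist-step-away : ∀ {x y w z q dx dy} → Dist G z x dx → Dist G z y dy → dy ≡ dx + suc q →
                   Adj x w → Walk G w y q → Dist G z w (suc dx)
  Dist-step-away {q = q} {dx} {dy} Dx Dy eq e rest =
    cast (+-comm dx 1) (proj₁ Dx ++ʷ step e here) ,
    λ k walk → +-cancelʳ-≤ q (suc dx) k
      (subst (_≤ k + q) (trans eq (+-suc dx q)) (proj₂ Dy _ (walk ++ʷ rest)))

  -- w is the vertex after x on a geodesic from x to y, and y lies on a geodesic from z to x.
  Dist-step-toward : ∀ {x y w z q dx dy} → Dist G z x dx → Dist G z y dy → dx ≡ dy + suc q →
                     Adj x w → Walk G w y q → Dist G z w (dy + q)
  Dist-step-toward {q = q} {dx} {dy} Dx Dy eq e rest =
    (proj₁ Dy ++ʷ reverse rest) ,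
    λ k walk → +-cancelʳ-≤ 1 (dy + q) k
      (subst (_≤ k + 1) (trans eq (solve (dy ∷ q ∷ []))) (proj₂ Dx _ (walk ++ʷ step (symAdj e) here)))

  record Sides (p q r s : Fin n) : Set where
    field
      x y : ℕ
      pq : Dist G p q x
      qr : Dist G q r y
      rs : Dist G r s x
      sp : Dist G s p y
      pr : Dist G p r (x + y)
      qs : Dist G q s (x + y)
      p≢q : p ≢ q
      q≢r : q ≢ r
      r≢s : r ≢ s
      s≢p : s ≢ p

  -- From x + y = z + w and y + z = w + x (the two diagonals) one gets x = z and y = w.
  parallelogram-sides : ∀ {p q r s} → Parallelogram G p q r s → Sides p q r s
  parallelogram-sides {p} {q} {r} {s}
    ((p≢q , q≢r , _ , x , y , Dpq , Dqr , Dpr) ,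
     (_ , r≢s , _ , y′ , z , Dqr′ , Drs , Dqs) ,
     (_ , s≢p , _ , z′ , w , Drs′ , Dsp , Drp) ,
     (_ , _ , _ , w′ , x′ , Dsp′ , Dpq′ , Dsq)) = record
       { x = x ; y = y ; pq = Dpq ; qr = Dqr
       ; rs = subst (Dist G r s) (sym x≡z) Drs
       ; sp = subst (Dist G s p) (sym y≡w) Dsp
       ; pr = Dpr
       ; qs = subst (Dist G q s) (trans (cong (_+ z) y′≡y) (trans (+-comm y z) (cong (_+ y) (sym x≡z)))) Dqs
       ; p≢q = p≢q ; q≢r = q≢r ; r≢s = r≢s ; s≢p = s≢p }
    where
    open ≡-Reasoning
    y′≡y : y′ ≡ y
    y′≡y = Dist-unique Dqr′ Dqr
    x+y≡z+w : x + y ≡ z + w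
    x+y≡z+w = trans (Dist-unique Dpr (Dist-sym Drp)) (cong (_+ w) (Dist-unique Drs′ Drs))
    y+z≡w+x : y + z ≡ w + x
    y+z≡w+x = trans (cong (_+ z) (sym y′≡y))
      (trans (Dist-unique Dqs (Dist-sym Dsq)) (cong₂ _+_ (Dist-unique Dsp′ Dsp) (Dist-unique Dpq′ Dpq)))
    y≡w : y ≡ w
    y≡w = m+m≡n+n⇒m≡n y w (+-cancelˡ-≡ (x + z) _ _ (begin
      (x + z) + (y + y) ≡⟨ solve (x ∷ y ∷ z ∷ []) ⟩
      (x + y) + (y + z) ≡⟨ cong₂ _+_ x+y≡z+w y+z≡w+x ⟩
      (z + w) + (w + x) ≡⟨ solve (x ∷ z ∷ w ∷ []) ⟩
      (x + z) + (w + w) ∎))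
    x≡z : x ≡ z
    x≡z = +-cancelʳ-≡ y x z (trans x+y≡z+w (cong (z +_) (sym y≡w)))

-- Families of pairwise antipodal pairs

module AntipodalFamily {n Q : ℕ} (G : Graph n) (a b : Fin (2 + Q) → Fin n)
  (a≢b : ∀ i → a i ≢ b i)
  (antipodal : ∀ i j → i ≢ j → Antipodal G (a i) (b i) (a j) (b j)) where
  open Metric G

  Index : Set
  Index = Fin (2 + Q)

  End : Set
  End = Index × Bool

  vertex : End → Fin n
  vertex (i , true) = a i
  vertex (i , false) = b i

  opposite : End → End
  opposite (i , s) = i , not s

  pair : End → Index
  pair = proj₁

  sides : ∀ i j → i ≢ j → Sides (a i) (a j) (b i) (b j)
  sides i j i≢j = parallelogram-sides (antipodal i j i≢j)

  partner : (i : Index) → ∃ λ (j : Index) → i ≢ j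
  partner fzero = fsuc fzero , λ ()
  partner (fsuc i) = fzero , λ ()

  δ-exists : ∀ P R → ∃ (Dist G (vertex P) (vertex R))
  δ-exists (i , s) (j , t) with i ≟ j
  ... | yes refl = within s t
    where
    S : Sides (a i) (a (proj₁ (partner i))) (b i) (b (proj₁ (partner i)))
    S = sides i (proj₁ (partner i)) (proj₂ (partner i))
    within : ∀ s t → ∃ (Dist G (vertex (i , s)) (vertex (i , t)))
    within true true = 0 , Dist-refl
    within true false = _ , Sides.pr S
    within false true = _ , Dist-sym (Sides.pr S)
    within false false = 0 , Dist-refl
  ... | no i≢j = across s t
    where
    S : Sides (a i) (a j) (b i) (b j)
    S = sides i j i≢j
    across : ∀ s t → ∃ (Dist G (vertex (i , s)) (vertex (j , t)))
    across true true = _ , Sides.pq S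
    across true false = _ , Dist-sym (Sides.sp S)
    across false true = _ , Dist-sym (Sides.qr S)
    across false false = _ , Sides.rs S

  δ : End → End → ℕ
  δ P R = proj₁ (δ-exists P R)

  δ-Dist : ∀ P R → Dist G (vertex P) (vertex R) (δ P R)
  δ-Dist P R = proj₂ (δ-exists P R)

  δ≡ : ∀ P R {d} → Dist G (vertex P) (vertex R) d → δ P R ≡ d
  δ≡ P R = Dist-unique (δ-Dist P R)

  δ-sym : ∀ P R → δ P R ≡ δ R P
  δ-sym P R = δ≡ P R (Dist-sym (δ-Dist R P))

  δ-self : ∀ P → δ P P ≡ 0
  δ-self P = δ≡ P P Dist-refl

  D : ℕ
  D = δ (fzero , true) (fzero , false)

  δ-pair≡D : ∀ i → δ (i , true) (i , false) ≡ D
  δ-pair≡D i with i ≟ fzero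
  ... | yes refl = refl
  ... | no i≢0 =
    trans (δ≡ (i , true) (i , false) (Sides.pr S)) (sym (δ≡ (fzero , true) (fzero , false) (Sides.qs S)))
    where
    S : Sides (a i) (a fzero) (b i) (b fzero)
    S = sides i fzero i≢0

  vertex-injective : ∀ P R → vertex P ≡ vertex R → P ≡ R
  vertex-injective (i , s) (j , t) e with i ≟ j
  vertex-injective (i , true) (.i , true) e | yes refl = refl
  vertex-injective (i , true) (.i , false) e | yes refl = ⊥-elim (a≢b i e)
  vertex-injective (i , false) (.i , true) e | yes refl = ⊥-elim (a≢b i (sym e))
  vertex-injective (i , false) (.i , false) e | yes refl = refl
  vertex-injective (i , true) (j , true) e | no i≢j = ⊥-elim (Sides.p≢q (sides i j i≢j) e)
  vertex-injective (i , true) (j , false) e | no i≢j = ⊥-elim (Sides.s≢p (sides i j i≢j) (sym e))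
  vertex-injective (i , false) (j , true) e | no i≢j = ⊥-elim (Sides.q≢r (sides i j i≢j) (sym e))
  vertex-injective (i , false) (j , false) e | no i≢j = ⊥-elim (Sides.r≢s (sides i j i≢j) e)

  pair≢⇒vertex≢ : ∀ P R → pair P ≢ pair R → vertex P ≢ vertex R
  pair≢⇒vertex≢ P R i≢j e = i≢j (cong pair (vertex-injective P R e))

  vertex≢opposite : ∀ P → vertex P ≢ vertex (opposite P)
  vertex≢opposite (i , true) e = a≢b i e
  vertex≢opposite (i , false) e = a≢b i (sym e)

  δ≡0⇒vertex≡ : ∀ P R → δ P R ≡ 0 → vertex P ≡ vertex R
  δ≡0⇒vertex≡ P R e = Dist-0⇒≡ (subst (Dist G (vertex P) (vertex R)) e (δ-Dist P R))

  δ+δ-opposite : ∀ P R → δ P R + δ P (opposite R) ≡ D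
  δ+δ-opposite (i , s) (j , t) = by-cases (i ≟ j) s t
    where
    by-cases : Dec (i ≡ j) → ∀ s t → δ (i , s) (j , t) + δ (i , s) (j , not t) ≡ D
    by-cases (yes refl) true true = trans (cong (_+ δ (i , true) (i , false)) (δ-self (i , true))) (δ-pair≡D i)
    by-cases (yes refl) true false = trans (cong₂ _+_ (δ-pair≡D i) (δ-self (i , true))) (+-identityʳ D)
    by-cases (yes refl) false true =
      trans (cong₂ _+_ (trans (δ-sym (i , false) (i , true)) (δ-pair≡D i)) (δ-self (i , false))) (+-identityʳ D)
    by-cases (yes refl) false false =
      trans (cong₂ _+_ (δ-self (i , false)) (δ-sym (i , false) (i , true))) (δ-pair≡D i)
    by-cases (no i≢j) s t = trans (across s t) (trans (sym (δ≡ (i , true) (i , false) pr)) (δ-pair≡D i))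
      where
      open Sides (sides i j i≢j)
      across : ∀ s t → δ (i , s) (j , t) + δ (i , s) (j , not t) ≡ x + y
      across true true = cong₂ _+_ (δ≡ (i , true) (j , true) pq) (δ≡ (i , true) (j , false) (Dist-sym sp))
      across true false =
        trans (cong₂ _+_ (δ≡ (i , true) (j , false) (Dist-sym sp)) (δ≡ (i , true) (j , true) pq)) (+-comm y x)
      across false true =
        trans (cong₂ _+_ (δ≡ (i , false) (j , true) (Dist-sym qr)) (δ≡ (i , false) (j , false) rs)) (+-comm y x)
      across false false = cong₂ _+_ (δ≡ (i , false) (j , false) rs) (δ≡ (i , false) (j , true) (Dist-sym qr))

  δ-opposite+δ : ∀ P R → δ P R + δ (opposite P) R ≡ D
  δ-opposite+δ P R = trans (cong₂ _+_ (δ-sym P R) (δ-sym (opposite P) R)) (δ+δ-opposite R P)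

  δ-opposite-opposite : ∀ P R → δ (opposite P) (opposite R) ≡ δ P R
  δ-opposite-opposite P R = +-cancelˡ-≡ (δ (opposite P) R) _ _
    (trans (δ+δ-opposite (opposite P) R) (trans (sym (δ-opposite+δ P R)) (+-comm (δ P R) (δ (opposite P) R))))

  δ-pos : ∀ P R → pair P ≢ pair R → 1 ≤ δ P R
  δ-pos P R i≢j = ≢⇒Dist-pos (pair≢⇒vertex≢ P R i≢j) (δ-Dist P R)

  δ<D : ∀ P R → pair P ≢ pair R → δ P R < D
  δ<D P R i≢j = subst (δ P R <_) (δ+δ-opposite P R)
    (subst (_≤ δ P R + δ P (opposite R)) (+-comm (δ P R) 1) (+-monoʳ-≤ (δ P R) (δ-pos P (opposite R) i≢j)))

  δ-Betw : ∀ P R T → Betw G (vertex P) (vertex R) (vertex T) → δ P T ≡ δ P R + δ R T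
  δ-Betw P R T B = Betw⇒≡+ B (δ-Dist P R) (δ-Dist R T) (δ-Dist P T)

  L : End → End → Fin n → Set
  L u v = Line G (vertex u) (vertex v)

  -- u lies between z and v, allowing z = u.
  Behind : End → End → End → Set
  Behind u v z = δ z v ≡ δ z u + δ u v

  behind-self : ∀ u v → Behind u v u
  behind-self u v = cong (_+ δ u v) (sym (δ-self u))

  behind-opposite : ∀ u v z → Behind u v z → δ z (opposite u) ≡ δ z (opposite v) + δ u v
  behind-opposite u v z behind = trans (+-cancelˡ-≡ (δ z u) _ _ (begin
      δ z u + δ z (opposite u)             ≡⟨ δ+δ-opposite z u ⟩
      D                                    ≡⟨ sym (δ+δ-opposite z v) ⟩
      δ z v + δ z (opposite v)             ≡⟨ cong (_+ δ z (opposite v)) behind ⟩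
      (δ z u + δ u v) + δ z (opposite v)   ≡⟨ +-assoc (δ z u) _ _ ⟩
      δ z u + (δ u v + δ z (opposite v))   ∎))
    (+-comm (δ u v) (δ z (opposite v)))
    where open ≡-Reasoning

  opposite-on-lineˡ : ∀ u v → pair u ≢ pair v → L u v (vertex (opposite u))
  opposite-on-lineˡ u v u∦v = beyond
    (betw (pair≢⇒vertex≢ u v u∦v) (pair≢⇒vertex≢ v (opposite u) (λ e → u∦v (sym e)))
          (vertex≢opposite u)
          (δ-Dist u v) (δ-Dist v (opposite u)) (δ-Dist u (opposite u))
          (trans (trans (cong (_+ δ u (opposite u)) (sym (δ-self u))) (δ+δ-opposite u u))
                 (trans (sym (δ+δ-opposite v u)) (cong (_+ δ v (opposite u)) (δ-sym v u)))))

  opposite-on-lineʳ : ∀ u v → pair u ≢ pair v → L u v (vertex (opposite v))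
  opposite-on-lineʳ u v u∦v = Line-swap (opposite-on-lineˡ v u (λ e → u∦v (sym e)))

  -- Distances to z and to its opposite are complementary (they sum to D > δ u v).
  inside⇒opposite-off-line : ∀ u v z → pair u ≢ pair v →
    Betw G (vertex u) (vertex z) (vertex v) → ¬ L u v (vertex (opposite z))
  inside⇒opposite-off-line u v z u∦v uzv = off
    where
    q A B A* B* : ℕ
    q = δ u v
    A = δ z u
    B = δ z v
    A* = δ (opposite z) u
    B* = δ (opposite z) v
    q≡A+B : q ≡ A + B
    q≡A+B = trans (δ-Betw u z v uzv) (cong (_+ B) (δ-sym u z))
    A+A* : A + A* ≡ D
    A+A* = δ-opposite+δ z u
    B+B* : B + B* ≡ D
    B+B* = δ-opposite+δ z v
    q<D : q < D
    q<D = δ<D u v u∦v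
    D≤q : ∀ {X Y} → X + Y ≡ D → Y ≡ 0 → X ≤ q → ⊥
    D≤q {X} {Y} X+Y Y≡0 X≤q = <⇒≱ q<D
      (subst (_≤ q) (trans (sym (+-identityʳ X)) (trans (cong (X +_) (sym Y≡0)) X+Y)) X≤q)
    twice-zero : ∀ q X Y Y* X* → Y* ≡ X* + q → q ≡ X + Y → X + X* ≡ Y + Y* → Y ≡ 0
    twice-zero q X Y Y* X* e₁ e₂ e₃ = m+n≡0⇒m≡0 Y (+-cancelʳ-≡ (X + X*) (Y + Y) 0 (begin
      (Y + Y) + (X + X*)   ≡⟨ solve (X ∷ Y ∷ X* ∷ []) ⟩
      Y + ((X + Y) + X*)   ≡⟨ cong (λ t → Y + (t + X*)) (sym e₂) ⟩
      Y + (q + X*)         ≡⟨ cong (Y +_) (trans (+-comm q X*) (sym e₁)) ⟩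
      Y + Y*               ≡⟨ sym e₃ ⟩
      X + X*               ∎))
      where open ≡-Reasoning
    off : ¬ L u v (vertex (opposite z))
    off (at-left e) = D≤q A+A* (≡⇒Dist-0 e (δ-Dist (opposite z) u)) (subst (A ≤_) (sym q≡A+B) (m≤m+n A B))
    off (at-right e) = D≤q B+B* (≡⇒Dist-0 e (δ-Dist (opposite z) v)) (subst (B ≤_) (sym q≡A+B) (m≤n+m B A))
    off (inside uz*v) = <-irrefl (m+m≡n+n⇒m≡n q D (begin
      q + q                ≡⟨ cong₂ _+_ q≡A+B q≡A*+B* ⟩
      (A + B) + (A* + B*)  ≡⟨ interchange A B A* B* ⟩
      (A + A*) + (B + B*)  ≡⟨ cong₂ _+_ A+A* B+B* ⟩
      D + D                ∎)) q<D
      where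
      open ≡-Reasoning
      q≡A*+B* : q ≡ A* + B*
      q≡A*+B* = trans (δ-Betw u (opposite z) v uz*v) (cong (_+ B*) (δ-sym u (opposite z)))
    off (before z*uv) = proj₁ (proj₂ uzv)
      (δ≡0⇒vertex≡ z v (twice-zero q A B B* A* (δ-Betw (opposite z) u v z*uv) q≡A+B (trans A+A* (sym B+B*))))
    off (beyond uvz*) = proj₁ uzv (sym (δ≡0⇒vertex≡ z u (twice-zero q B A A* B*
      (trans (δ-sym (opposite z) u)
        (trans (δ-Betw u v (opposite z) uvz*) (trans (+-comm q _) (cong (_+ q) (δ-sym v (opposite z))))))
      (trans q≡A+B (+-comm A B)) (trans B+B* (sym A+A*)))))

  opposites-on-line⇒behind : ∀ u v z → pair u ≢ pair v →
    L u v (vertex z) → L u v (vertex (opposite z)) → Behind u v z ⊎ Behind v u z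
  opposites-on-line⇒behind u v z u∦v (at-left e) _ with vertex-injective z u e
  ... | refl = inj₁ (behind-self z v)
  opposites-on-line⇒behind u v z u∦v (at-right e) _ with vertex-injective z v e
  ... | refl = inj₂ (behind-self z u)
  opposites-on-line⇒behind u v z u∦v (inside uzv) z*∈uv =
    ⊥-elim (inside⇒opposite-off-line u v z u∦v uzv z*∈uv)
  opposites-on-line⇒behind u v z u∦v (before zuv) _ = inj₁ (δ-Betw z u v zuv)
  opposites-on-line⇒behind u v z u∦v (beyond uvz) _ =
    inj₂ (trans (δ-sym z u) (trans (δ-Betw u v z uvz)
      (trans (+-comm (δ u v) (δ v z)) (cong₂ _+_ (δ-sym v z) (δ-sym u v)))))

  module FarPair (α β γ ε : End) (α∦β : pair α ≢ pair β) (γ∦ε : pair γ ≢ pair ε)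
    (not-αβ : ¬ (pair γ ≡ pair α × pair ε ≡ pair β))
    (p : ℕ) (δαβ : δ α β ≡ 2 + p)
    (same : SameLine G (vertex α) (vertex β) (vertex γ) (vertex ε))
    (γ-behind-α : Behind α β γ) where

    δβα : δ β α ≡ 2 + p
    δβα = trans (δ-sym β α) δαβ

    to-αβ : ∀ {w} → L γ ε w → L α β w
    to-αβ {w} = proj₂ (same w)

    to-γε : ∀ {w} → L α β w → L γ ε w
    to-γε {w} = proj₁ (same w)

    α-side : Behind γ ε α ⊎ Behind ε γ α
    α-side = opposites-on-line⇒behind γ ε α γ∦ε
      (to-γε (at-left refl)) (to-γε (opposite-on-lineˡ α β α∦β))

    β-side : Behind γ ε β ⊎ Behind ε γ β
    β-side = opposites-on-line⇒behind γ ε β γ∦ε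
      (to-γε (at-right refl)) (to-γε (opposite-on-lineʳ α β α∦β))

    ε-side : Behind α β ε ⊎ Behind β α ε
    ε-side = opposites-on-line⇒behind α β ε α∦β
      (to-αβ (at-right refl)) (to-αβ (opposite-on-lineʳ γ ε γ∦ε))

    -- If ε is behind α too, the first step w₂ from opposite α towards opposite β is on γε but not on αβ.
    step₂ : Σ (Fin n) λ w → Graph.Adj G (vertex (opposite α)) w × Walk G w (vertex (opposite β)) (suc p)
    step₂ = first-step
      (cast (trans (δ-opposite-opposite α β) δαβ) (proj₁ (δ-Dist (opposite α) (opposite β))))

    w₂ : Fin n
    w₂ = proj₁ step₂

    Dist-w₂-behind-α : ∀ z → Behind α β z → Dist G (vertex z) w₂ (δ z (opposite β) + suc p)
    Dist-w₂-behind-α z behind = Dist-step-toward (δ-Dist z (opposite α)) (δ-Dist z (opposite β))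
      (trans (behind-opposite α β z behind) (cong (δ z (opposite β) +_) δαβ))
      (proj₁ (proj₂ step₂)) (proj₂ (proj₂ step₂))

    Dist-w₂-behind-β : ∀ z → Behind β α z → Dist G (vertex z) w₂ (suc (δ z (opposite α)))
    Dist-w₂-behind-β z behind = Dist-step-away (δ-Dist z (opposite α)) (δ-Dist z (opposite β))
      (trans (behind-opposite β α z behind) (cong (δ z (opposite α) +_) δβα))
      (proj₁ (proj₂ step₂)) (proj₂ (proj₂ step₂))

    c c′ : ℕ
    c = δ α (opposite β)
    c′ = δ β (opposite α)

    c′≡c : c′ ≡ c
    c′≡c = +-cancelˡ-≡ (δ α β) c′ c
      (trans (cong (_+ c′) (sym (δ-sym β α))) (trans (δ+δ-opposite β α) (sym (δ+δ-opposite α β))))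

    Dα-w₂ : Dist G (vertex α) w₂ (c + suc p)
    Dα-w₂ = Dist-w₂-behind-α α (behind-self α β)

    Dβ-w₂ : Dist G (vertex β) w₂ (suc c′)
    Dβ-w₂ = Dist-w₂-behind-β β (behind-self β α)

    ¬[αw₂β] : ∀ c c′ → 1 ≤ c → 2 + p ≢ (c + suc p) + suc c′
    ¬[αw₂β] (suc c) c′ _ e = m+1+n≢m (2 + p) {c + c′} (sym (trans e (solve (c ∷ p ∷ c′ ∷ []))))

    ¬[w₂αβ] : ∀ c p → suc c ≢ (c + suc p) + (2 + p)
    ¬[w₂αβ] c p e = m+1+n≢m (suc c) {suc (p + p)} (sym (trans e (solve (c ∷ p ∷ []))))

    ¬[αβw₂] : ∀ c p → c + suc p ≢ (2 + p) + suc c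
    ¬[αβw₂] c p e = m+1+n≢m (c + suc p) {1} (sym (trans e (solve (c ∷ p ∷ []))))

    w₂∉αβ : ¬ L α β w₂
    w₂∉αβ (at-left e) = Dist-≢0⇒≢ Dα-w₂ (m+1+n≢0 c) (sym e)
    w₂∉αβ (at-right e) = Dist-≢0⇒≢ Dβ-w₂ (λ ()) (sym e)
    w₂∉αβ (inside αw₂β) = ¬[αw₂β] c c′ (δ-pos α (opposite β) α∦β)
      (trans (sym δαβ) (Betw⇒≡+ αw₂β Dα-w₂ (Dist-sym Dβ-w₂) (δ-Dist α β)))
    w₂∉αβ (before w₂αβ) = ¬[w₂αβ] c p (trans (cong suc (sym c′≡c))
      (trans (Betw⇒≡+ w₂αβ (Dist-sym Dα-w₂) (δ-Dist α β) (Dist-sym Dβ-w₂))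
             (cong ((c + suc p) +_) δαβ)))
    w₂∉αβ (beyond αβw₂) = ¬[αβw₂] c p
      (trans (Betw⇒≡+ αβw₂ (δ-Dist α β) Dβ-w₂ Dα-w₂) (cong₂ (λ s t → s + suc t) δαβ c′≡c))

    Betw-w₂ : ∀ x y → Behind α β x → Behind α β y → pair x ≢ pair y → δ α y ≡ δ α x + δ x y →
              Betw G (vertex x) (vertex y) w₂
    Betw-w₂ x y x-behind y-behind x∦y αxy =
      betw (pair≢⇒vertex≢ x y x∦y) (Dist-≢0⇒≢ Dy (m+1+n≢0 _)) (Dist-≢0⇒≢ Dx (m+1+n≢0 _))
           (δ-Dist x y) Dy Dx
           (trans (cong (_+ suc p) via-y) (+-assoc (δ x y) _ _))
      where
      Dx : Dist G (vertex x) w₂ (δ x (opposite β) + suc p)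
      Dx = Dist-w₂-behind-α x x-behind
      Dy : Dist G (vertex y) w₂ (δ y (opposite β) + suc p)
      Dy = Dist-w₂-behind-α y y-behind
      shift : ∀ X Y X* Y* d q → (X + d) + X* ≡ (Y + d) + Y* → Y ≡ X + q → X* ≡ q + Y*
      shift X Y X* Y* d q e₁ e₂ = +-cancelˡ-≡ (X + d) X* (q + Y*)
        (trans e₁ (trans (cong (λ t → (t + d) + Y*) e₂) (solve (X ∷ q ∷ d ∷ Y* ∷ []))))
      via-y : δ x (opposite β) ≡ δ x y + δ y (opposite β)
      via-y = shift (δ x α) (δ y α) (δ x (opposite β)) (δ y (opposite β)) (δ α β) (δ x y)
        (trans (cong (_+ δ x (opposite β)) (sym x-behind))
          (trans (δ+δ-opposite x β) (trans (sym (δ+δ-opposite y β)) (cong (_+ δ y (opposite β)) y-behind))))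
        (trans (δ-sym y α) (trans αxy (cong (_+ δ x y) (δ-sym α x))))

    both-behind-α : Behind α β ε → ⊥
    both-behind-α ε-behind-α = w₂∉αβ (to-αβ w₂∈γε)
      where
      w₂∈γε : L γ ε w₂
      w₂∈γε with α-side
      ... | inj₁ αγε = beyond (Betw-w₂ γ ε γ-behind-α ε-behind-α γ∦ε αγε)
      ... | inj₂ αεγ =
        before (Betw-reverse (Betw-w₂ ε γ ε-behind-α γ-behind-α (λ e → γ∦ε (sym e)) αεγ))

    -- If ε is behind β, the first step w₁ from α towards β is on αβ, and on γε only if γ = α and ε = β.
    step₁ : Σ (Fin n) λ w → Graph.Adj G (vertex α) w × Walk G w (vertex β) (suc p)
    step₁ = first-step (cast δαβ (proj₁ (δ-Dist α β)))

    w₁ : Fin n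
    w₁ = proj₁ step₁

    Dist-w₁-behind-α : ∀ z → Behind α β z → Dist G (vertex z) w₁ (suc (δ z α))
    Dist-w₁-behind-α z behind = Dist-step-away (δ-Dist z α) (δ-Dist z β)
      (trans behind (cong (δ z α +_) δαβ)) (proj₁ (proj₂ step₁)) (proj₂ (proj₂ step₁))

    Dist-w₁-behind-β : ∀ z → Behind β α z → Dist G (vertex z) w₁ (δ z β + suc p)
    Dist-w₁-behind-β z behind = Dist-step-toward (δ-Dist z α) (δ-Dist z β)
      (trans behind (cong (δ z β +_) δβα)) (proj₁ (proj₂ step₁)) (proj₂ (proj₂ step₁))

    w₁∈αβ : L α β w₁
    w₁∈αβ = inside (betw (Dist-≢0⇒≢ Dα (λ ())) (λ e → Dist-≢0⇒≢ Dβ (m+1+n≢0 _) (sym e))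
      (pair≢⇒vertex≢ α β α∦β) Dα (Dist-sym Dβ) (δ-Dist α β)
      (trans δαβ (cong₂ (λ s t → suc s + (t + suc p)) (sym (δ-self α)) (sym (δ-self β)))))
      where
      Dα : Dist G (vertex α) w₁ (suc (δ α α))
      Dα = Dist-w₁-behind-α α (behind-self α β)
      Dβ : Dist G (vertex β) w₁ (δ β β + suc p)
      Dβ = Dist-w₁-behind-β β (behind-self β α)

    -- With g = δ γ α, f = δ ε β, d = δ γ ε and P = δ α β, the positions of α and β
    -- relative to γε leave only f + P = g + d and g + P = f + d, i.e. g = f and d = P.
    equal-offsets : ∀ g f d P′ → let P = suc P′ in
      (f + P ≡ g + d) ⊎ (g ≡ (f + P) + d) → (f ≡ (g + P) + d) ⊎ (g + P ≡ f + d) → g ≡ f × d ≡ P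
    equal-offsets g f d P′ (inj₁ e₁) (inj₂ e₂) = g≡f , d≡P
      where
      open ≡-Reasoning
      P : ℕ
      P = suc P′
      d≡P : d ≡ P
      d≡P = sym (m+m≡n+n⇒m≡n P d (+-cancelˡ-≡ (f + g) _ _ (begin
        (f + g) + (P + P)   ≡⟨ solve (f ∷ g ∷ P′ ∷ []) ⟩
        (f + P) + (g + P)   ≡⟨ cong₂ _+_ e₁ e₂ ⟩
        (g + d) + (f + d)   ≡⟨ solve (f ∷ g ∷ d ∷ []) ⟩
        (f + g) + (d + d)   ∎)))
      g≡f : g ≡ f
      g≡f = sym (+-cancelʳ-≡ P f g (trans e₁ (cong (g +_) d≡P)))
    equal-offsets g f d P′ (inj₁ e₁) (inj₁ e₂) = ⊥-elim (m+1+n≢m (g + d) {P′ + suc P′} (begin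
      (g + d) + suc (P′ + suc P′)    ≡⟨ solve (g ∷ d ∷ P′ ∷ []) ⟩
      ((g + suc P′) + d) + suc P′    ≡⟨ cong (_+ suc P′) (sym e₂) ⟩
      f + suc P′                     ≡⟨ e₁ ⟩
      g + d                          ∎))
      where open ≡-Reasoning
    equal-offsets g f d P′ (inj₂ e₁) (inj₁ e₂) = ⊥-elim (m+1+n≢m g {P′ + suc (P′ + d + d)} (begin
      g + suc (P′ + suc (P′ + d + d))    ≡⟨ solve (g ∷ d ∷ P′ ∷ []) ⟩
      (((g + suc P′) + d) + suc P′) + d  ≡⟨ cong (λ t → (t + suc P′) + d) (sym e₂) ⟩
      (f + suc P′) + d                   ≡⟨ sym e₁ ⟩
      g                                  ∎))
      where open ≡-Reasoning
    equal-offsets g f d P′ (inj₂ e₁) (inj₂ e₂) = ⊥-elim (m+1+n≢m (f + d) {P′ + suc P′} (begin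
      (f + d) + suc (P′ + suc P′)    ≡⟨ solve (f ∷ d ∷ P′ ∷ []) ⟩
      ((f + suc P′) + d) + suc P′    ≡⟨ cong (_+ suc P′) (sym e₁) ⟩
      g + suc P′                     ≡⟨ e₂ ⟩
      f + d                          ∎))
      where open ≡-Reasoning

    behind-α-and-β : Behind β α ε → ⊥
    behind-α-and-β ε-behind-β = w₁∉γε (to-γε w₁∈αβ)
      where
      g f d : ℕ
      g = δ γ α
      f = δ ε β
      d = δ γ ε
      δαε : δ α ε ≡ f + (2 + p)
      δαε = trans (δ-sym α ε) (trans ε-behind-β (cong (f +_) δβα))
      δβγ : δ β γ ≡ g + (2 + p)
      δβγ = trans (δ-sym β γ) (trans γ-behind-α (cong (g +_) δαβ))
      α-offset : (f + (2 + p) ≡ g + d) ⊎ (g ≡ (f + (2 + p)) + d)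
      α-offset with α-side
      ... | inj₁ αγε = inj₁ (trans (sym δαε) (trans αγε (cong (_+ d) (δ-sym α γ))))
      ... | inj₂ αεγ = inj₂ (trans (δ-sym γ α) (trans αεγ (cong₂ _+_ δαε (δ-sym ε γ))))
      β-offset : (f ≡ (g + (2 + p)) + d) ⊎ (g + (2 + p) ≡ f + d)
      β-offset with β-side
      ... | inj₁ βγε = inj₁ (trans (δ-sym ε β) (trans βγε (cong (_+ d) δβγ)))
      ... | inj₂ βεγ = inj₂ (trans (sym δβγ) (trans βεγ (cong₂ _+_ (δ-sym β ε) (δ-sym ε γ))))
      g≡f : g ≡ f
      g≡f = proj₁ (equal-offsets g f d (suc p) α-offset β-offset)
      d≡2+p : d ≡ 2 + p
      d≡2+p = proj₂ (equal-offsets g f d (suc p) α-offset β-offset)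
      Dγ : Dist G (vertex γ) w₁ (suc g)
      Dγ = Dist-w₁-behind-α γ γ-behind-α
      Dε : Dist G (vertex ε) w₁ (g + suc p)
      Dε = subst (λ t → Dist G (vertex ε) w₁ (t + suc p)) (sym g≡f) (Dist-w₁-behind-β ε ε-behind-β)
      [γw₁ε]⇒g≡0 : ∀ g → 2 + p ≡ suc g + (g + suc p) → g ≡ 0
      [γw₁ε]⇒g≡0 g e =
        m+n≡0⇒m≡0 g (+-cancelʳ-≡ (2 + p) (g + g) 0 (sym (trans e (solve (g ∷ p ∷ [])))))
      ¬[w₁γε] : ∀ g → g + suc p ≢ suc g + (2 + p)
      ¬[w₁γε] g e = m+1+n≢m (g + suc p) {1} (sym (trans e (solve (g ∷ p ∷ []))))
      ¬[γεw₁] : ∀ g → suc g ≢ (2 + p) + (g + suc p)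
      ¬[γεw₁] g e = m+1+n≢m (suc g) {suc (p + p)} (sym (trans e (solve (g ∷ p ∷ []))))
      w₁∉γε : ¬ L γ ε w₁
      w₁∉γε (at-left e) = Dist-≢0⇒≢ Dγ (λ ()) (sym e)
      w₁∉γε (at-right e) = Dist-≢0⇒≢ Dε (m+1+n≢0 g) (sym e)
      w₁∉γε (inside γw₁ε) = not-αβ
        ( cong pair (vertex-injective γ α (δ≡0⇒vertex≡ γ α g=0))
        , cong pair (vertex-injective ε β (δ≡0⇒vertex≡ ε β (trans (sym g≡f) g=0))))
        where
        g=0 : g ≡ 0
        g=0 = [γw₁ε]⇒g≡0 g (trans (sym d≡2+p) (Betw⇒≡+ γw₁ε Dγ (Dist-sym Dε) (δ-Dist γ ε)))
      w₁∉γε (before w₁γε) =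
        ¬[w₁γε] g (trans (Betw⇒≡+ w₁γε (Dist-sym Dγ) (δ-Dist γ ε) (Dist-sym Dε))
                         (cong (suc g +_) d≡2+p))
      w₁∉γε (beyond γεw₁) =
        ¬[γεw₁] g (trans (Betw⇒≡+ γεw₁ (δ-Dist γ ε) Dε Dγ) (cong (_+ (g + suc p)) d≡2+p))

    contradiction : ⊥
    contradiction with ε-side
    ... | inj₁ ε-behind-α = both-behind-α ε-behind-α
    ... | inj₂ ε-behind-β = behind-α-and-β ε-behind-β

  far-pair-lines-differ : ∀ α β γ ε → pair α ≢ pair β → pair γ ≢ pair ε →
    ¬ (pair γ ≡ pair α × pair ε ≡ pair β) → ¬ (pair γ ≡ pair β × pair ε ≡ pair α) →
    2 ≤ δ α β → ¬ SameLine G (vertex α) (vertex β) (vertex γ) (vertex ε)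
  far-pair-lines-differ α β γ ε α∦β γ∦ε not-αβ not-βα 2≤δαβ same
    with m≤n⇒∃[o]m+o≡n 2≤δαβ
       | opposites-on-line⇒behind α β γ α∦β
           (proj₂ (same _) (at-left refl)) (proj₂ (same _) (opposite-on-lineˡ γ ε γ∦ε))
  ... | p , 2+p≡δαβ | inj₁ γ-behind-α =
    FarPair.contradiction α β γ ε α∦β γ∦ε not-αβ p (sym 2+p≡δαβ) same γ-behind-α
  ... | p , 2+p≡δαβ | inj₂ γ-behind-β =
    FarPair.contradiction β α γ ε (λ e → α∦β (sym e)) γ∦ε not-βα
      p (trans (δ-sym β α) (sym 2+p≡δαβ)) (SameLine-swapˡ same) γ-behind-β

  D≡2⇒δ≡1 : D ≡ 2 → ∀ P R → pair P ≢ pair R → δ P R ≡ 1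
  D≡2⇒δ≡1 D≡2 P R P∦R = ≤-antisym
    (+-cancelʳ-≤ 1 (δ P R) 1 (subst (δ P R + 1 ≤_) (trans (δ+δ-opposite P R) D≡2)
      (+-monoʳ-≤ (δ P R) (δ-pos P (opposite R) P∦R))))
    (δ-pos P R P∦R)

  D≡2⇒on-line⇒pair : D ≡ 2 → ∀ u v z → pair u ≢ pair v → L u v (vertex z) →
    pair z ≡ pair u ⊎ pair z ≡ pair v
  D≡2⇒on-line⇒pair D≡2 u v z u∦v z∈uv with pair z ≟ pair u | pair z ≟ pair v
  ... | yes z~u | _ = inj₁ z~u
  ... | no _ | yes z~v = inj₂ z~v
  ... | no z∦u | no z∦v = ⊥-elim (off z∈uv)
    where
    δ≡1 : ∀ P R → pair P ≢ pair R → δ P R ≡ 1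
    δ≡1 = D≡2⇒δ≡1 D≡2
    off : ¬ L u v (vertex z)
    off (at-left e) = z∦u (cong pair (vertex-injective z u e))
    off (at-right e) = z∦v (cong pair (vertex-injective z v e))
    off (inside uzv) with trans (sym (δ≡1 u v u∦v)) (trans (δ-Betw u z v uzv)
      (cong₂ _+_ (δ≡1 u z (λ e → z∦u (sym e))) (δ≡1 z v z∦v)))
    ... | ()
    off (before zuv) with trans (sym (δ≡1 z v z∦v)) (trans (δ-Betw z u v zuv)
      (cong₂ _+_ (δ≡1 z u z∦u) (δ≡1 u v u∦v)))
    ... | ()
    off (beyond uvz) with trans (sym (δ≡1 u z (λ e → z∦u (sym e)))) (trans (δ-Betw u v z uvz)
      (cong₂ _+_ (δ≡1 u v u∦v) (δ≡1 v z (λ e → z∦v (sym e)))))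
    ... | ()

  D≡2⇒lines-differ : D ≡ 2 → ∀ α β γ ε → pair α ≢ pair β → pair γ ≢ pair ε →
    ¬ (pair γ ≡ pair α × pair ε ≡ pair β) → ¬ (pair γ ≡ pair β × pair ε ≡ pair α) →
    ¬ SameLine G (vertex α) (vertex β) (vertex γ) (vertex ε)
  D≡2⇒lines-differ D≡2 α β γ ε α∦β γ∦ε not-αβ not-βα same
    with D≡2⇒on-line⇒pair D≡2 α β γ α∦β (proj₂ (same _) (at-left refl))
       | D≡2⇒on-line⇒pair D≡2 α β ε α∦β (proj₂ (same _) (at-right refl))
  ... | inj₁ γ~α | inj₁ ε~α = γ∦ε (trans γ~α (sym ε~α))
  ... | inj₁ γ~α | inj₂ ε~β = not-αβ (γ~α , ε~β)
  ... | inj₂ γ~β | inj₁ ε~α = not-βα (γ~β , ε~α)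
  ... | inj₂ γ~β | inj₂ ε~β = γ∦ε (trans γ~β (sym ε~β))

  choose : Index → Index → Bool
  choose i j = isYes (2 ≤? δ (i , true) (j , true))

  -- δ (i , true) (j , true) + δ (i , true) (j , false) = D, so both are 1 only when D = 2.
  choose-far : ∀ i j → i ≢ j → 2 ≤ δ (i , true) (j , choose i j) ⊎ D ≡ 2
  choose-far i j i≢j = by-cases (2 ≤? δ (i , true) (j , true)) (2 ≤? δ (i , true) (j , false))
    where
    ≤1 : ∀ t → ¬ 2 ≤ δ (i , true) (j , t) → δ (i , true) (j , t) ≡ 1
    ≤1 t ≱2 = ≤-antisym (≤-pred (≰⇒> ≱2)) (δ-pos (i , true) (j , t) i≢j)
    by-cases : (d : Dec (2 ≤ δ (i , true) (j , true))) → Dec (2 ≤ δ (i , true) (j , false)) →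
               2 ≤ δ (i , true) (j , isYes d) ⊎ D ≡ 2
    by-cases (yes far) _ = inj₁ far
    by-cases (no _) (yes far) = inj₁ far
    by-cases (no near) (no near′) =
      inj₂ (trans (sym (δ+δ-opposite (i , true) (j , true))) (cong₂ _+_ (≤1 true near) (≤1 false near′)))

  chosen-lines-differ : ∀ i j k l → i ≢ j → k ≢ l → ¬ (k ≡ i × l ≡ j) → ¬ (k ≡ j × l ≡ i) →
    ¬ SameLine G (a i) (vertex (j , choose i j)) (a k) (vertex (l , choose k l))
  chosen-lines-differ i j k l i≢j k≢l not-ij not-ji with choose-far i j i≢j
  ... | inj₁ far =
    far-pair-lines-differ (i , true) (j , choose i j) (k , true) (l , choose k l) i≢j k≢l not-ij not-ji far
  ... | inj₂ D≡2 =
    D≡2⇒lines-differ D≡2 (i , true) (j , choose i j) (k , true) (l , choose k l) i≢j k≢l not-ij not-ji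

-- Counting

pairs : ℕ → ℕ
pairs zero = 0
pairs (suc Q) = Q + pairs Q

enumerate : ∀ Q → Fin (pairs Q) → Fin Q × Fin Q
enumerate-step : ∀ Q → Fin Q ⊎ Fin (pairs Q) → Fin (suc Q) × Fin (suc Q)
enumerate-step Q (inj₁ j) = fromℕ Q , inject₁ j
enumerate-step Q (inj₂ k) = inject₁ (proj₁ (enumerate Q k)) , inject₁ (proj₂ (enumerate Q k))
enumerate (suc Q) k = enumerate-step Q (splitAt Q k)

enumerate-descending : ∀ Q k → toℕ (proj₂ (enumerate Q k)) < toℕ (proj₁ (enumerate Q k))
enumerate-step-descending : ∀ Q s → toℕ (proj₂ (enumerate-step Q s)) < toℕ (proj₁ (enumerate-step Q s))
enumerate-step-descending Q (inj₁ j) = subst₂ _<_ (sym (toℕ-inject₁ j)) (sym (toℕ-fromℕ Q)) (toℕ<n j)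
enumerate-step-descending Q (inj₂ k) =
  subst₂ _<_ (sym (toℕ-inject₁ _)) (sym (toℕ-inject₁ _)) (enumerate-descending Q k)
enumerate-descending (suc Q) k = enumerate-step-descending Q (splitAt Q k)

enumerate-injective : ∀ Q k l → enumerate Q k ≡ enumerate Q l → k ≡ l
enumerate-step-injective : ∀ Q s t → enumerate-step Q s ≡ enumerate-step Q t → s ≡ t
enumerate-step-injective Q (inj₁ j) (inj₁ j′) e = cong inj₁ (inject₁-injective (cong proj₂ e))
enumerate-step-injective Q (inj₁ j) (inj₂ k) e =
  ⊥-elim (<-irrefl (trans (sym (toℕ-inject₁ _)) (trans (cong (toℕ ∘ proj₁) (sym e)) (toℕ-fromℕ Q)))
                   (toℕ<n _))
enumerate-step-injective Q (inj₂ k) (inj₁ j) e =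
  ⊥-elim (<-irrefl (trans (sym (toℕ-inject₁ _)) (trans (cong (toℕ ∘ proj₁) e) (toℕ-fromℕ Q)))
                   (toℕ<n _))
enumerate-step-injective Q (inj₂ k) (inj₂ k′) e = cong inj₂ (enumerate-injective Q k k′
  (cong₂ _,_ (inject₁-injective (cong proj₁ e)) (inject₁-injective (cong proj₂ e))))
enumerate-injective (suc Q) k l e = begin
  k                              ≡⟨ sym (join-splitAt Q (pairs Q) k) ⟩
  join Q (pairs Q) (splitAt Q k) ≡⟨ cong (join Q (pairs Q)) (enumerate-step-injective Q _ _ e) ⟩
  join Q (pairs Q) (splitAt Q l) ≡⟨ join-splitAt Q (pairs Q) l ⟩
  l                              ∎
  where open ≡-Reasoning

2*pairs+Q≡Q*Q : ∀ Q → 2 * pairs Q + Q ≡ Q * Q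
2*pairs+Q≡Q*Q zero = refl
2*pairs+Q≡Q*Q (suc Q) = begin
  2 * (Q + pairs Q) + suc Q           ≡⟨ regroup Q (pairs Q) ⟩
  (2 * pairs Q + Q) + (2 * Q + 1)     ≡⟨ cong (_+ (2 * Q + 1)) (2*pairs+Q≡Q*Q Q) ⟩
  Q * Q + (2 * Q + 1)                 ≡⟨ solve (Q ∷ []) ⟩
  suc Q * suc Q                       ∎
  where
  open ≡-Reasoning
  regroup : ∀ Q t → 2 * (Q + t) + suc Q ≡ (2 * t + Q) + (2 * Q + 1)
  regroup = solve-∀

pairs-bound : ∀ k Q → k + 1 ≤ Q → (k + 1) * (Q * Q) ≤ 2 * (k + 1) * pairs Q + 2 * (Q * Q)
pairs-bound k Q k+1≤Q = begin
  (k + 1) * (Q * Q)                     ≡⟨ cong ((k + 1) *_) (sym (2*pairs+Q≡Q*Q Q)) ⟩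
  (k + 1) * (2 * pairs Q + Q)           ≡⟨ distrib k Q (pairs Q) ⟩
  2 * (k + 1) * pairs Q + (k + 1) * Q   ≤⟨ +-monoʳ-≤ (2 * (k + 1) * pairs Q) [k+1]Q≤2Q² ⟩
  2 * (k + 1) * pairs Q + 2 * (Q * Q)   ∎
  where
  open ≤-Reasoning
  [k+1]Q≤2Q² : (k + 1) * Q ≤ 2 * (Q * Q)
  [k+1]Q≤2Q² = ≤-trans (*-monoˡ-≤ Q k+1≤Q) (m≤m+n (Q * Q) (Q * Q + 0))
  distrib : ∀ k Q t → (k + 1) * (2 * t + Q) ≡ 2 * (k + 1) * t + (k + 1) * Q
  distrib = solve-∀

antipodal-family-lines : ∀ Q {n} (G : Graph n) (a b : Fin Q → Fin n) → (∀ i → a i ≢ b i) →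
  (∀ i j → i ≢ j → Antipodal G (a i) (b i) (a j) (b j)) → AtLeastLines G (pairs Q)
antipodal-family-lines zero G a b a≢b antipodal = (λ ()) , (λ ()) , (λ ()) , (λ ())
antipodal-family-lines (suc zero) G a b a≢b antipodal = (λ ()) , (λ ()) , (λ ()) , (λ ())
antipodal-family-lines (suc (suc Q)) G a b a≢b antipodal = u , v , u≢v , lines-differ
  where
  open AntipodalFamily G a b a≢b antipodal
  i j : Fin (pairs (2 + Q)) → Index
  i k = proj₁ (enumerate (2 + Q) k)
  j k = proj₂ (enumerate (2 + Q) k)
  u v : Fin (pairs (2 + Q)) → Fin _
  u k = a (i k)
  v k = vertex (j k , choose (i k) (j k))
  i≢j : ∀ k → i k ≢ j k
  i≢j k e = <-irrefl (cong toℕ (sym e)) (enumerate-descending (2 + Q) k)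
  u≢v : ∀ k → u k ≢ v k
  u≢v k = pair≢⇒vertex≢ (i k , true) (j k , choose (i k) (j k)) (i≢j k)
  lines-differ : ∀ k l → k ≢ l → ¬ SameLine G (u k) (v k) (u l) (v l)
  lines-differ k l k≢l = chosen-lines-differ (i k) (j k) (i l) (j l) (i≢j k) (i≢j l)
    (λ (e₁ , e₂) → k≢l (enumerate-injective (2 + Q) k l (sym (cong₂ _,_ e₁ e₂))))
    (λ (e₁ , e₂) → <-asym (enumerate-descending (2 + Q) k)
                     (subst₂ _<_ (cong toℕ e₂) (cong toℕ e₁) (enumerate-descending (2 + Q) l)))

γRelated⇒Antipodal : ∀ {n} {G : Graph n} {a b x y} → γRelated G a b x y → Antipodal G a b x y
γRelated⇒Antipodal (_ , _ , _ , _ , antipodal , _) = antipodal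

mainTheorem18 : (k : ℕ) → Σ ℕ λ Q₀ → (Q : ℕ) → 1 ≤ Q → Q₀ ≤ Q →
    (n : ℕ) (G : Graph n) → Connected G →
    (a b : Fin Q → Fin n) →
    (∀ i → a i ≢ b i) →
    (∀ i j → i ≢ j → SameLine G (a i) (b i) (a j) (b j) × γRelated G (a i) (b i) (a j) (b j)) →
    Σ ℕ λ m → AtLeastLines G m × ((k + 1) * (Q * Q) ≤ 2 * (k + 1) * m + 2 * (Q * Q))
mainTheorem18 k = k + 1 , λ Q _ k+1≤Q n G _ a b a≢b related →
  pairs Q ,
  antipodal-family-lines Q G a b a≢b (λ i j i≢j → γRelated⇒Antipodal (proj₂ (related i j i≢j))) ,
  pairs-bound k Q k+1≤Q
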